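{- There exists a deterministic algorithm which, given access to the independent set oracle of a simple undirected graph $G$ on $n$ vertices and given a vertex set $A$, outputs a list of pairwise vertex-disjoint edges of the subgraph of $G$ induced on $A$ such that the set of all endpoints of the listed edges is a vertex cover of the subgraph induced on $A$, and such that for every $i$ the $i$-th edge of the list is found after $O(1+i\log n)$ independent set queries.
   Context: Independent set oracle: given a vertex set $U$, it returns $1$ if no edge of $G$ has both endpoints in $U$, and $0$ otherwise. The constants in $O(\cdot)$ are absolute. -}

module Defs where

open import Data.Nat using (ℕ; zero; suc; _+_)
open import Data.Bool using (Bool; true; false)
open import Data.Fin using (Fin)
open import Data.Fin.Subset using (Subset; _∈_)
open import Data.List using (List; []; _∷_; map)
open import Data.Product using (_×_; _,_; proj₁; proj₂; Σ)
open import Relation.Binary.PropositionalEquality using (_≡_)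
open import Function.Bundles using (_⇔_)
open import Data.Sum using (_⊎_)

record Graph (n : ℕ) : Set where
  field
    adj     : Fin n → Fin n → Bool
    adj-sym : ∀ u v → adj u v ≡ adj v u
    adj-irr : ∀ v → adj v v ≡ false
open Graph public

IsIndependent : ∀ {n} → Graph n → Subset n → Set
IsIndependent G U = ∀ u v → u ∈ U → v ∈ U → adj G u v ≡ false

IsIndepOracle : ∀ {n} → Graph n → (Subset n → Bool) → Set
IsIndepOracle G O = ∀ U → (O U ≡ true) ⇔ IsIndependent G U

-- A deterministic oracle algorithm on vertex set Fin n, as a (finite) decision
-- tree: it may ask an independent set query on a vertex set and branch on the
-- answer, output (emit) an edge {u,v} and continue, or halt.
data Alg (n : ℕ) : Set where
  done  : Alg n
  query : Subset n → (Bool → Alg n) → Alg n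
  emit  : Fin n → Fin n → Alg n → Alg n

-- Running an algorithm against an oracle, with q = number of queries made so
-- far.
run : ∀ {n} → (Subset n → Bool) → Alg n → ℕ → List ((Fin n × Fin n) × ℕ)
run O done          q = []
run O (query U k)   q = run O (k (O U)) (suc q)
run O (emit u v a)  q = ((u , v) , q) ∷ run O a q

outputs : ∀ {n} → (Subset n → Bool) → Alg n → List (Fin n × Fin n)
outputs O a = map proj₁ (run O a 0)

IsEndpoint : ∀ {n} → Fin n → Fin n × Fin n → Set
IsEndpoint x (u , v) = (x ≡ u) ⊎ (x ≡ v)

-- Greedy maximal matching, each edge located by two binary searches.  While the
-- remaining vertex set R is dependent, a binary search over the prefixes R ↾ c
-- (the vertices of R of index below c) finds c₁ with R ↾ c₁ independent and
-- R ↾ (c₁ + 1) dependent, so the vertex v of index c₁ lies in R and has a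
-- neighbour in R ↾ c₁.  A second binary search over the sets ⁅ v ⁆ ∪ R ↾ c finds
-- such a neighbour u in the same way.  With K = ⌈log₂ n⌉ each edge costs 1 + 2K
-- queries.  Deleting u and v makes the edges pairwise disjoint, and since the
-- process stops only when the remaining vertices are independent, their
-- endpoints cover every edge of G[A].

module Submission where

open import Defs
open import Data.Nat using (ℕ; suc; _+_; _*_; _≤_)
open import Data.Nat.Logarithm using (⌈log₂_⌉)
open import Data.Bool using (Bool; true)
open import Data.Empty using (⊥)
open import Data.Fin using (Fin; toℕ)
open import Data.Fin.Subset using (Subset; _∈_)
open import Data.List using (length; lookup)
open import Data.Product using (Σ; _×_; _,_; proj₁; proj₂)
open import Data.Sum using (_⊎_)
open import Relation.Binary.PropositionalEquality using (_≡_; _≢_)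

open import Data.Nat using (zero; _<_; _^_; z≤n; s≤s; s≤s⁻¹; ⌈_/2⌉; ⌊_/2⌋; NonZero)
open import Data.Nat.Properties
  using ( +-comm; +-assoc; +-suc; +-identityʳ; *-identityʳ; <-irrefl; <-trans; <⇒≤; ≰⇒>
        ; ≤-trans; ≤-reflexive; <-≤-trans; ≤-<-trans; m<1+n⇒m<n∨m≡n; m≤n+m
        ; +-monoʳ-≤; +-monoˡ-≤; *-monoʳ-≤; ⌊n/2⌋≤⌈n/2⌉; ⌊n/2⌋+⌈n/2⌉≡n; ⌈n/2⌉<n
        ; module ≤-Reasoning )
open import Data.Nat.DivMod using (_mod_; m<n⇒m%n≡m)
open import Data.Nat.Induction using (<-wellFounded)
open import Data.Nat.Logarithm using (⌈log₂⌉-mono-≤)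
open import Data.Nat.Logarithm.Core using (⌈log2⌉)
open import Data.Nat.Tactic.RingSolver using (solve-∀)
open import Data.Bool using (false; if_then_else_)
open import Data.Bool.Properties using (¬-not) renaming (_≟_ to _≟ᵇ_)
open import Data.Empty using (⊥-elim)
open import Data.Fin using (zero; suc; _≟_)
open import Data.Fin.Properties using (toℕ-injective; toℕ<n; toℕ-fromℕ<; any?)
open import Data.Fin.Subset using (_∉_; _⊆_; _∪_; ⁅_⁆; _-_; ∣_∣) renaming (⊥ to ∅)
open import Data.Fin.Subset.Properties
  using ( _∈?_; ∉⊥; x∈⁅x⁆; x∈⁅y⁆⇒x≡y; x∈p∪q⁺; x∈p∪q⁻; q⊆p∪q; ∪-assoc; ∪-comm
        ; ⊆-trans; ⊆-reflexive; p─q⊆p; x∈p∧x≢y⇒x∈p-y; ∣p∣≤n; ∣p─q∣≤∣p∣; x∈p⇒∣p-x∣<∣p∣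
        ; p⊆q⇒∣p∣≤∣q∣; ∣⁅x⁆∣≡1 )
open import Data.List using (List; []; _∷_)
open import Data.Vec using ([]; _∷_; here; there)
open import Data.Product using (∃-syntax)
import Data.Product as Product
open import Data.Sum using (inj₁; inj₂)
import Data.Sum as Sum
open import Function using (_∘_; id)
open import Function.Bundles using (Equivalence)
open import Induction.WellFounded using (Acc; acc)
open import Relation.Nullary using (¬_; yes; no; contradiction)
open import Relation.Nullary.Decidable using (Dec; _×-dec_; _⊎-dec_; decidable-stable)
open import Relation.Binary.PropositionalEquality
  using (refl; sym; trans; cong; subst; module ≡-Reasoning)

infixl 8 _↾_

_↾_ : ∀ {n} → Subset n → ℕ → Subset n
[]      ↾ c     = []
(_ ∷ _) ↾ zero  = ∅
(s ∷ p) ↾ suc c = s ∷ p ↾ c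

∈↾⁺ : ∀ {n} {p : Subset n} {x c} → x ∈ p → toℕ x < c → x ∈ p ↾ c
∈↾⁺ here        (s≤s _)  = here
∈↾⁺ (there x∈p) (s≤s lt) = there (∈↾⁺ x∈p lt)

∈↾⁻ : ∀ {n} {p : Subset n} {x c} → x ∈ p ↾ c → x ∈ p × toℕ x < c
∈↾⁻ {p = _ ∷ _} {c = zero}  x∈             = ⊥-elim (∉⊥ x∈)
∈↾⁻ {p = _ ∷ _} {c = suc c} here           = here , s≤s z≤n
∈↾⁻ {p = _ ∷ _} {c = suc c} (there x∈p↾c) = Product.map there s≤s (∈↾⁻ x∈p↾c)

∉↾0 : ∀ {n} {p : Subset n} {x} → x ∉ p ↾ 0
∉↾0 {p = p} x∈ with () ← proj₂ (∈↾⁻ {p = p} x∈)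

↾-mono : ∀ {n} {p : Subset n} {c d} → c ≤ d → p ↾ c ⊆ p ↾ d
↾-mono {p = p} c≤d x∈ = let x∈p , x<c = ∈↾⁻ {p = p} x∈ in ∈↾⁺ x∈p (<-≤-trans x<c c≤d)

⊆↾ : ∀ {n} {p : Subset n} {c} → n ≤ c → p ⊆ p ↾ c
⊆↾ n≤c {x} x∈p = ∈↾⁺ x∈p (<-≤-trans (toℕ<n x) n≤c)

toℕ-mod : ∀ {n c} .{{_ : NonZero n}} → c < n → toℕ (c mod n) ≡ c
toℕ-mod c<n = trans (toℕ-fromℕ< _) (m<n⇒m%n≡m c<n)

↾-suc-⊆ : ∀ {n} .{{_ : NonZero n}} {p : Subset n} {c} → p ↾ suc c ⊆ p ↾ c ∪ ⁅ c mod n ⁆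
↾-suc-⊆ {n} {p} {c} {x} x∈ with ∈↾⁻ {p = p} x∈
... | x∈p , x<1+c with m<1+n⇒m<n∨m≡n x<1+c
...   | inj₁ x<c = x∈p∪q⁺ (inj₁ (∈↾⁺ x∈p x<c))
...   | inj₂ x≡c = x∈p∪q⁺ (inj₂ (subst (_∈ ⁅ c mod n ⁆) (sym x≡c') (x∈⁅x⁆ _)))
  where
  x≡c' : x ≡ c mod n
  x≡c' = toℕ-injective (trans x≡c (sym (toℕ-mod (subst (_< n) x≡c (toℕ<n x)))))

∪-monoʳ-⊆ : ∀ {n} (r : Subset n) {p q} → p ⊆ q → r ∪ p ⊆ r ∪ q
∪-monoʳ-⊆ r p⊆q x∈ = x∈p∪q⁺ (Sum.map₂ p⊆q (x∈p∪q⁻ r _ x∈))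

x∉p-x : ∀ {n} (p : Subset n) x → x ∉ p - x
x∉p-x (_ ∷ p) zero    ()
x∉p-x (_ ∷ p) (suc x) (there x∈) = x∉p-x p x x∈

x∈p⇒0<∣p∣ : ∀ {n} {p : Subset n} {x} → x ∈ p → 0 < ∣ p ∣
x∈p⇒0<∣p∣ {p = p} {x} x∈p = subst (_≤ ∣ p ∣) (∣⁅x⁆∣≡1 x) (p⊆q⇒∣p∣≤∣q∣ ⁅x⁆⊆p)
  where
  ⁅x⁆⊆p : ⁅ x ⁆ ⊆ p
  ⁅x⁆⊆p y∈⁅x⁆ = subst (_∈ p) (sym (x∈⁅y⁆⇒x≡y x y∈⁅x⁆)) x∈p

module _ {n} {u v : Fin n} {p : Subset n} {x : Fin n} where

  ∈-removeEdge⁺ : x ∈ p → ¬ IsEndpoint x (u , v) → x ∈ p - u - v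
  ∈-removeEdge⁺ x∈p x∉e = x∈p∧x≢y⇒x∈p-y (x∈p∧x≢y⇒x∈p-y x∈p (x∉e ∘ inj₁)) (x∉e ∘ inj₂)

  ∈-removeEdge⁻ : x ∈ p - u - v → x ∈ p × ¬ IsEndpoint x (u , v)
  ∈-removeEdge⁻ x∈ = p─q⊆p p ⁅ u ⁆ (p─q⊆p (p - u) ⁅ v ⁆ x∈) , λ where
    (inj₁ refl) → x∉p-x p u (p─q⊆p (p - u) ⁅ v ⁆ x∈)
    (inj₂ refl) → x∉p-x (p - u) v x∈

module _ {n} (G : Graph n) where

  independent-⊆ : ∀ {p q} → p ⊆ q → IsIndependent G q → IsIndependent G p
  independent-⊆ p⊆q q-indep u v u∈p v∈p = q-indep u v (p⊆q u∈p) (p⊆q v∈p)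

  ⁅⁆-independent : ∀ x → IsIndependent G ⁅ x ⁆
  ⁅⁆-independent x u v u∈ v∈ rewrite x∈⁅y⁆⇒x≡y x u∈ | x∈⁅y⁆⇒x≡y x v∈ = adj-irr G x

  ∪⁅⁆-independent : ∀ {p x} → IsIndependent G p → (∀ y → y ∈ p → adj G x y ≡ false) →
                    IsIndependent G (p ∪ ⁅ x ⁆)
  ∪⁅⁆-independent {p} {x} p-indep x-isolated u v u∈ v∈
    with x∈p∪q⁻ p ⁅ x ⁆ u∈ | x∈p∪q⁻ p ⁅ x ⁆ v∈
  ... | inj₁ u∈p  | inj₁ v∈p  = p-indep u v u∈p v∈p
  ... | inj₁ u∈p  | inj₂ v∈⁅x⁆ rewrite x∈⁅y⁆⇒x≡y x v∈⁅x⁆ = trans (adj-sym G u x) (x-isolated u u∈p)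
  ... | inj₂ u∈⁅x⁆ | inj₁ v∈p rewrite x∈⁅y⁆⇒x≡y x u∈⁅x⁆ = x-isolated v v∈p
  ... | inj₂ u∈⁅x⁆ | inj₂ v∈⁅x⁆ = ⁅⁆-independent x u v u∈⁅x⁆ v∈⁅x⁆

  dependent-∪⁅⁆⇒neighbour : ∀ {p q x} → IsIndependent G p → ¬ IsIndependent G q → q ⊆ p ∪ ⁅ x ⁆ →
                            x ∈ q × ∃[ y ] (y ∈ p × adj G x y ≡ true)
  dependent-∪⁅⁆⇒neighbour {p} {q} {x} p-indep q-dep q⊆ = x∈q , neighbour
    where
    x∈q : x ∈ q
    x∈q = decidable-stable (x ∈? q) λ x∉q → q-dep (independent-⊆ (q⊆p x∉q) p-indep)
      where
      q⊆p : x ∉ q → q ⊆ p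
      q⊆p x∉q {y} y∈q with x∈p∪q⁻ p ⁅ x ⁆ (q⊆ y∈q)
      ... | inj₁ y∈p   = y∈p
      ... | inj₂ y∈⁅x⁆ = contradiction (subst (_∈ q) (x∈⁅y⁆⇒x≡y x y∈⁅x⁆) y∈q) x∉q
    neighbour : ∃[ y ] (y ∈ p × adj G x y ≡ true)
    neighbour with any? (λ y → y ∈? p ×-dec adj G x y ≟ᵇ true)
    ... | yes found = found
    ... | no ¬found = ⊥-elim (q-dep (independent-⊆ q⊆ (∪⁅⁆-independent p-indep isolated)))
      where
      isolated : ∀ y → y ∈ p → adj G x y ≡ false
      isolated y y∈p = ¬-not λ x~y → ¬found (y , y∈p , x~y)

boundary : (ℕ → Bool) → ℕ → ℕ → ℕ
boundary f zero    c = c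
boundary f (suc j) c = boundary f j (if f (c + 2 ^ j) then c + 2 ^ j else c)

boundary-spec : ∀ (f : ℕ → Bool) j c → f c ≡ true → f (c + 2 ^ j) ≡ false →
                f (boundary f j c) ≡ true × f (suc (boundary f j c)) ≡ false
boundary-spec f zero    c fc fc+1 = fc , subst (λ m → f m ≡ false) (+-comm c 1) fc+1
boundary-spec f (suc j) c fc fc+2^j+2^j with f (c + 2 ^ j) in fmid
... | true  = boundary-spec f j (c + 2 ^ j) fmid (subst (λ m → f m ≡ false) split fc+2^j+2^j)
  where
  split : c + 2 ^ suc j ≡ c + 2 ^ j + 2 ^ j
  split = trans (cong (λ m → c + (2 ^ j + m)) (+-identityʳ (2 ^ j))) (sym (+-assoc c (2 ^ j) (2 ^ j)))
... | false = boundary-spec f j c fc fmid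

search : ∀ {n} → (ℕ → Subset n) → ℕ → ℕ → (ℕ → Alg n) → Alg n
search S zero    c k = k c
search S (suc j) c k = query (S (c + 2 ^ j)) λ b → search S j (if b then c + 2 ^ j else c) k

run-search : ∀ {n} O (S : ℕ → Subset n) j c k q →
             run O (search S j c k) q ≡ run O (k (boundary (O ∘ S) j c)) (q + j)
run-search O S zero    c k q = cong (run O (k c)) (sym (+-identityʳ q))
run-search O S (suc j) c k q =
  trans (run-search O S j _ k (suc q)) (cong (run O (k (boundary (O ∘ S) (suc j) c))) (sym (+-suc q j)))

module _ {n} .{{_ : NonZero n}} (K : ℕ) where

  mutual
    greedyMatching : ℕ → Subset n → Alg n
    greedyMatching zero    R = done
    greedyMatching (suc f) R = query R λ independent → if independent then done else matchEdge f R

    matchEdge : ℕ → Subset n → Alg n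
    matchEdge f R =
      search (R ↾_) K 0 λ c₁ →
      search (λ c → ⁅ c₁ mod n ⁆ ∪ R ↾ c) K 0 λ c₂ →
      emit (c₂ mod n) (c₁ mod n) (greedyMatching f (R - c₂ mod n - c₁ mod n))

-- For n ≤ 1 there is no edge, and ⌈log₂ n⌉ = 0 would leave no room for any query.
matchingAlgorithm : (n : ℕ) → Subset n → Alg n
matchingAlgorithm zero          A = done
matchingAlgorithm (suc zero)    A = done
matchingAlgorithm (suc (suc m)) A = greedyMatching ⌈log₂ suc (suc m) ⌉ (suc (suc m)) A

data GreedyTrace {n} (G : Graph n) (cost : ℕ) : Subset n → ℕ → List ((Fin n × Fin n) × ℕ) → Set where
  stop : ∀ {R q} → IsIndependent G R → GreedyTrace G cost R q []
  pick : ∀ {R q u v t L} → adj G u v ≡ true → u ∈ R → v ∈ R → t ≡ q + cost →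
         GreedyTrace G cost (R - u - v) t L → GreedyTrace G cost R q (((u , v) , t) ∷ L)

endpoint? : ∀ {n} (x : Fin n) e → Dec (IsEndpoint x e)
endpoint? x (u , v) = x ≟ u ⊎-dec x ≟ v

module _ {n} {G : Graph n} {cost : ℕ} where

  trace-edges : ∀ {R q L} → GreedyTrace G cost R q L → ∀ i →
                let (u , v) = proj₁ (lookup L i) in adj G u v ≡ true × u ∈ R × v ∈ R
  trace-edges (pick u~v u∈R v∈R _ _) zero    = u~v , u∈R , v∈R
  trace-edges (pick _ _ _ _ t)       (suc i) =
    Product.map₂ (Product.map (proj₁ ∘ ∈-removeEdge⁻) (proj₁ ∘ ∈-removeEdge⁻)) (trace-edges t i)

  trace-endpoint∈ : ∀ {R q L} → GreedyTrace G cost R q L → ∀ i {x} →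
                    IsEndpoint x (proj₁ (lookup L i)) → x ∈ R
  trace-endpoint∈ t i (inj₁ refl) = proj₁ (proj₂ (trace-edges t i))
  trace-endpoint∈ t i (inj₂ refl) = proj₂ (proj₂ (trace-edges t i))

  trace-disjoint : ∀ {R q L} → GreedyTrace G cost R q L → ∀ i j → i ≢ j → ∀ x →
                   IsEndpoint x (proj₁ (lookup L i)) → IsEndpoint x (proj₁ (lookup L j)) → ⊥
  trace-disjoint (pick _ _ _ _ _) zero    zero    i≢j _ _   _    = i≢j refl
  trace-disjoint (pick _ _ _ _ t) zero    (suc j) _   _ x∈e x∈e' =
    proj₂ (∈-removeEdge⁻ (trace-endpoint∈ t j x∈e')) x∈e
  trace-disjoint (pick _ _ _ _ t) (suc i) zero    _   _ x∈e x∈e' =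
    proj₂ (∈-removeEdge⁻ (trace-endpoint∈ t i x∈e)) x∈e'
  trace-disjoint (pick _ _ _ _ t) (suc i) (suc j) i≢j = trace-disjoint t i j (i≢j ∘ cong suc)

  trace-cover : ∀ {R q L} → GreedyTrace G cost R q L → ∀ x y → x ∈ R → y ∈ R → adj G x y ≡ true →
                ∃[ i ] (IsEndpoint x (proj₁ (lookup L i)) ⊎ IsEndpoint y (proj₁ (lookup L i)))
  trace-cover (stop R-indep) x y x∈R y∈R x~y =
    contradiction (trans (sym x~y) (R-indep x y x∈R y∈R)) λ ()
  trace-cover (pick {u = u} {v} _ _ _ _ t) x y x∈R y∈R x~y
    with endpoint? x (u , v) | endpoint? y (u , v)
  ... | yes x∈e | _       = zero , inj₁ x∈e
  ... | no _    | yes y∈e = zero , inj₂ y∈e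
  ... | no x∉e  | no y∉e  =
    Product.map suc id (trace-cover t x y (∈-removeEdge⁺ x∈R x∉e) (∈-removeEdge⁺ y∈R y∉e) x~y)

  trace-time : ∀ {R q L} → GreedyTrace G cost R q L → ∀ i →
               proj₂ (lookup L i) ≡ q + suc (toℕ i) * cost
  trace-time {q = q} (pick _ _ _ t≡ _) zero    = trans t≡ (cong (q +_) (sym (+-identityʳ cost)))
  trace-time {q = q} (pick _ _ _ t≡ t) (suc i) =
    trans (trace-time t i) (trans (cong (_+ suc (toℕ i) * cost) t≡) (+-assoc q cost (suc (toℕ i) * cost)))

module Correctness {n} .{{_ : NonZero n}} {G : Graph n} {O : Subset n → Bool}
                   (spec : IsIndepOracle G O) (K : ℕ) (n≤2^K : n ≤ 2 ^ K) where

  cost : ℕ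
  cost = suc (K + K)

  independent⇒true : ∀ {U} → IsIndependent G U → O U ≡ true
  independent⇒true = Equivalence.from (spec _)

  true⇒independent : ∀ {U} → O U ≡ true → IsIndependent G U
  true⇒independent = Equivalence.to (spec _)

  false⇒dependent : ∀ {U} → O U ≡ false → ¬ IsIndependent G U
  false⇒dependent OU≡false U-indep with () ← trans (sym OU≡false) (independent⇒true U-indep)

  dependent⇒false : ∀ {U} → ¬ IsIndependent G U → O U ≡ false
  dependent⇒false U-dep = ¬-not (U-dep ∘ true⇒independent)

  search-boundary : ∀ (S : ℕ → Subset n) → IsIndependent G (S 0) → ¬ IsIndependent G (S (2 ^ K)) →
                    IsIndependent G (S (boundary (O ∘ S) K 0))
                    × ¬ IsIndependent G (S (suc (boundary (O ∘ S) K 0)))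
  search-boundary S first last =
    Product.map true⇒independent false⇒dependent
      (boundary-spec (O ∘ S) K 0 (independent⇒true first) (dependent⇒false last))

  module Step (R : Subset n) where

    c₁ : ℕ
    c₁ = boundary (O ∘ (R ↾_)) K 0

    v : Fin n
    v = c₁ mod n

    T : ℕ → Subset n
    T c = ⁅ v ⁆ ∪ R ↾ c

    c₂ : ℕ
    c₂ = boundary (O ∘ T) K 0

    u : Fin n
    u = c₂ mod n

    run-matchEdge : ∀ f q → run O (matchEdge K f R) q ≡
                    ((u , v) , q + K + K) ∷ run O (greedyMatching K f (R - u - v)) (q + K + K)
    run-matchEdge f q = trans (run-search O (R ↾_) K 0 _ q) (run-search O T K 0 _ (q + K))

    module _ (R-dependent : ¬ IsIndependent G R) where

      boundary₁ : IsIndependent G (R ↾ c₁) × ¬ IsIndependent G (R ↾ suc c₁)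
      boundary₁ = search-boundary (R ↾_) (λ x _ x∈ → ⊥-elim (∉↾0 {p = R} x∈))
                    (R-dependent ∘ independent-⊆ G (⊆↾ n≤2^K))

      c₁<n : c₁ < n
      c₁<n = ≰⇒> λ n≤c₁ → R-dependent (independent-⊆ G (⊆↾ n≤c₁) (proj₁ boundary₁))

      v∈R : v ∈ R
      v∈R = proj₁ (∈↾⁻ {p = R} (proj₁ (dependent-∪⁅⁆⇒neighbour G
              (proj₁ boundary₁) (proj₂ boundary₁) (↾-suc-⊆ {p = R}))))

      boundary₂ : IsIndependent G (T c₂) × ¬ IsIndependent G (T (suc c₂))
      boundary₂ = search-boundary T (independent-⊆ G T0⊆⁅v⁆ (⁅⁆-independent G v))
                    (R-dependent ∘ independent-⊆ G (⊆-trans (⊆↾ n≤2^K) (q⊆p∪q ⁅ v ⁆ _)))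
        where
        T0⊆⁅v⁆ : T 0 ⊆ ⁅ v ⁆
        T0⊆⁅v⁆ x∈ = Sum.[ id , ⊥-elim ∘ ∉↾0 {p = R} ] (x∈p∪q⁻ ⁅ v ⁆ (R ↾ 0) x∈)

      c₂<c₁ : c₂ < c₁
      c₂<c₁ = ≰⇒> λ c₁≤c₂ → proj₂ boundary₁ (independent-⊆ G (R↾1+c₁⊆T c₁≤c₂) (proj₁ boundary₂))
        where
        R↾1+c₁⊆T : c₁ ≤ c₂ → R ↾ suc c₁ ⊆ T c₂
        R↾1+c₁⊆T c₁≤c₂ = ⊆-trans (↾-suc-⊆ {p = R})
          (⊆-trans (⊆-reflexive (∪-comm (R ↾ c₁) ⁅ v ⁆)) (∪-monoʳ-⊆ ⁅ v ⁆ (↾-mono {p = R} c₁≤c₂)))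

      toℕu≡c₂ : toℕ u ≡ c₂
      toℕu≡c₂ = toℕ-mod (<-trans c₂<c₁ c₁<n)

      u≢v : u ≢ v
      u≢v u≡v = <-irrefl c₂≡c₁ c₂<c₁
        where
        c₂≡c₁ : c₂ ≡ c₁
        c₂≡c₁ = begin
          c₂     ≡⟨ toℕu≡c₂ ⟨
          toℕ u  ≡⟨ cong toℕ u≡v ⟩
          toℕ v  ≡⟨ toℕ-mod c₁<n ⟩
          c₁     ∎
          where open ≡-Reasoning

      partner : u ∈ T (suc c₂) × ∃[ y ] (y ∈ T c₂ × adj G u y ≡ true)
      partner = dependent-∪⁅⁆⇒neighbour G (proj₁ boundary₂) (proj₂ boundary₂)
        (⊆-trans (∪-monoʳ-⊆ ⁅ v ⁆ (↾-suc-⊆ {p = R}))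
                 (⊆-reflexive (sym (∪-assoc ⁅ v ⁆ (R ↾ c₂) ⁅ u ⁆))))

      u∈R : u ∈ R
      u∈R with x∈p∪q⁻ ⁅ v ⁆ (R ↾ suc c₂) (proj₁ partner)
      ... | inj₁ u∈⁅v⁆   = contradiction (x∈⁅y⁆⇒x≡y v u∈⁅v⁆) u≢v
      ... | inj₂ u∈R↾1+c₂ = proj₁ (∈↾⁻ {p = R} u∈R↾1+c₂)

      -- The neighbour of u found in T c₂ cannot lie in R ↾ c₂, which sits inside the
      -- independent set R ↾ c₁ together with u.
      u~v : adj G u v ≡ true
      u~v with proj₂ partner
      ... | y , y∈T , u~y with x∈p∪q⁻ ⁅ v ⁆ (R ↾ c₂) y∈T
      ...   | inj₁ y∈⁅v⁆  = subst (λ w → adj G u w ≡ true) (x∈⁅y⁆⇒x≡y v y∈⁅v⁆) u~y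
      ...   | inj₂ y∈R↾c₂ = contradiction (trans (sym u~y) (proj₁ boundary₁ u y u∈R↾c₁ y∈R↾c₁)) λ ()
        where
        u∈R↾c₁ : u ∈ R ↾ c₁
        u∈R↾c₁ = ∈↾⁺ u∈R (subst (_< c₁) (sym toℕu≡c₂) c₂<c₁)
        y∈R↾c₁ : y ∈ R ↾ c₁
        y∈R↾c₁ = ↾-mono {p = R} (<⇒≤ c₂<c₁) y∈R↾c₂

  greedyMatching-trace : ∀ f R q → ∣ R ∣ ≤ f →
                         GreedyTrace G cost R q (run O (greedyMatching K f R) q)
  greedyMatching-trace zero R q ∣R∣≤0 =
    stop λ x _ x∈R _ → contradiction (<-≤-trans (x∈p⇒0<∣p∣ x∈R) ∣R∣≤0) λ ()
  greedyMatching-trace (suc f) R q ∣R∣≤1+f with O R in OR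
  ... | true  = stop (true⇒independent OR)
  ... | false rewrite Step.run-matchEdge R f (suc q) =
    pick (u~v R-dependent) (u∈R R-dependent) (v∈R R-dependent) time
         (greedyMatching-trace f (R - u - v) (suc q + K + K) ∣R-u-v∣≤f)
    where
    open Step R
    R-dependent : ¬ IsIndependent G R
    R-dependent = false⇒dependent OR
    time : suc q + K + K ≡ q + cost
    time = trans (cong suc (+-assoc q K K)) (sym (+-suc q (K + K)))
    ∣R-u-v∣≤f : ∣ R - u - v ∣ ≤ f
    ∣R-u-v∣≤f = s≤s⁻¹ (≤-<-trans (∣p─q∣≤∣p∣ (R - u) ⁅ v ⁆)
                  (<-≤-trans (x∈p⇒∣p-x∣<∣p∣ (u∈R R-dependent)) ∣R∣≤1+f))

n≤2^⌈log₂n⌉ : ∀ n → n ≤ 2 ^ ⌈log₂ n ⌉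
n≤2^⌈log₂n⌉ n = go n (<-wellFounded n)
  where
  go : ∀ n (rec : Acc _<_ n) → n ≤ 2 ^ ⌈log2⌉ n rec
  go 0 _ = z≤n
  go 1 _ = s≤s z≤n
  go (suc (suc n)) (acc rs) = begin
    2 + n                    ≡⟨ cong (2 +_) (⌊n/2⌋+⌈n/2⌉≡n n) ⟨
    2 + (⌊ n /2⌋ + ⌈ n /2⌉)  ≤⟨ +-monoʳ-≤ 2 (+-monoˡ-≤ ⌈ n /2⌉ (⌊n/2⌋≤⌈n/2⌉ n)) ⟩
    2 + (⌈ n /2⌉ + ⌈ n /2⌉)  ≡⟨ 2+[m+m]≡2*[1+m] ⌈ n /2⌉ ⟩
    2 * suc ⌈ n /2⌉          ≤⟨ *-monoʳ-≤ 2 (go (suc ⌈ n /2⌉) (rs (⌈n/2⌉<n n))) ⟩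
    2 * 2 ^ ⌈log2⌉ (suc ⌈ n /2⌉) (rs (⌈n/2⌉<n n))  ∎
    where
    open ≤-Reasoning
    2+[m+m]≡2*[1+m] : ∀ m → 2 + (m + m) ≡ 2 * suc m
    2+[m+m]≡2*[1+m] = solve-∀

a*[1+2K]≤3*[1+a*K] : ∀ a {K} → 1 ≤ K → a * suc (K + K) ≤ 3 * (1 + a * K)
a*[1+2K]≤3*[1+a*K] a {K} 1≤K = begin
  a * suc (K + K)                ≡⟨ a*[1+K+K]≡a+[aK+aK] a K ⟩
  a + (a * K + a * K)            ≤⟨ +-monoˡ-≤ (a * K + a * K) a≤a*K ⟩
  a * K + (a * K + a * K)        ≤⟨ m≤n+m _ 3 ⟩
  3 + (a * K + (a * K + a * K))  ≡⟨ 3*[1+aK]≡3+[aK+aK+aK] a K ⟨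
  3 * (1 + a * K)                ∎
  where
  open ≤-Reasoning
  a≤a*K : a ≤ a * K
  a≤a*K = ≤-trans (≤-reflexive (sym (*-identityʳ a))) (*-monoʳ-≤ a 1≤K)
  a*[1+K+K]≡a+[aK+aK] : ∀ a K → a * suc (K + K) ≡ a + (a * K + a * K)
  a*[1+K+K]≡a+[aK+aK] = solve-∀
  3*[1+aK]≡3+[aK+aK+aK] : ∀ a K → 3 * (1 + a * K) ≡ 3 + (a * K + (a * K + a * K))
  3*[1+aK]≡3+[aK+aK+aK] = solve-∀

lemmaA3 : Σ ((n : ℕ) → Subset n → Alg n) λ alg → Σ ℕ λ C →
    ∀ (n : ℕ) (G : Graph n) (O : Subset n → Bool) → IsIndepOracle G O →
    ∀ (A : Subset n) →
      (∀ (i : Fin (length (run O (alg n A) 0))) →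
        adj G (proj₁ (proj₁ (lookup (run O (alg n A) 0) i)))
              (proj₂ (proj₁ (lookup (run O (alg n A) 0) i))) ≡ true
        × proj₁ (proj₁ (lookup (run O (alg n A) 0) i)) ∈ A
        × proj₂ (proj₁ (lookup (run O (alg n A) 0) i)) ∈ A)
      × (∀ (i j : Fin (length (run O (alg n A) 0))) → i ≢ j →
          ∀ (x : Fin n) →
          IsEndpoint x (proj₁ (lookup (run O (alg n A) 0) i)) →
          IsEndpoint x (proj₁ (lookup (run O (alg n A) 0) j)) → ⊥)
      × (∀ (u v : Fin n) → u ∈ A → v ∈ A → adj G u v ≡ true →
          Σ (Fin (length (run O (alg n A) 0))) λ i →
            IsEndpoint u (proj₁ (lookup (run O (alg n A) 0) i))
            ⊎ IsEndpoint v (proj₁ (lookup (run O (alg n A) 0) i)))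
      × (∀ (i : Fin (length (run O (alg n A) 0))) →
          proj₂ (lookup (run O (alg n A) 0) i)
            ≤ C * (1 + suc (toℕ i) * ⌈log₂ n ⌉))
lemmaA3 = matchingAlgorithm , 3 , λ where
  zero G O spec A → (λ ()) , (λ ()) , (λ ()) , (λ ())
  (suc zero) G O spec A →
    (λ ()) , (λ ()) , (λ { zero zero _ _ 0~0 → contradiction (trans (sym 0~0) (adj-irr G zero)) λ () }) , (λ ())
  (suc (suc m)) G O spec A →
    let n     = suc (suc m)
        K     = ⌈log₂ n ⌉
        1≤K   = ⌈log₂⌉-mono-≤ {2} {n} (s≤s (s≤s z≤n))
        trace = Correctness.greedyMatching-trace {G = G} spec K (n≤2^⌈log₂n⌉ n) n A 0 (∣p∣≤n A)
    in trace-edges trace , trace-disjoint trace , trace-cover trace ,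
       λ i → ≤-trans (≤-reflexive (trace-time trace i)) (a*[1+2K]≤3*[1+a*K] (suc (toℕ i)) 1≤K)
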